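{- Let $G$ be a positive definite even integral symmetric $n\times n$ matrix ($n\ge1$) of level $N$. Let $a$ be a nonzero integer and $c$ a positive integer with $\gcd(a,c)=1$ and $N\mid c$. Let $\mathbf{w}\in G^{ -1}\mathbb{Z}^n$ with $a\mathbf{w}\notin\mathbb{Z}^n$. Then: (1) if $H$ is a subgroup of $\mathbb{Z}^n/c\mathbb{Z}^n$ containing $cG^{ -1}\mathbb{Z}^n/c\mathbb{Z}^n$, then $\mathfrak{G}^H_G(a/c;\mathbf{w})=0$; (2) for every $\mathbf{x}\in\mathbb{Z}^n$, $\mathfrak{G}^{S_{\mathbf x}}_G(a/c;\mathbf{w})=0$, where $S_{\mathbf x}=\{\mathbf{y}+c\mathbb{Z}^n:\mathbf{y}\in\mathbf{x}+cG^{ -1}\mathbb{Z}^n\}$.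
   Context: $e(z)=\exp(2\pi i z)$. Even integral: integer entries, even diagonal; the level is the least positive $N$ with $NG^{ -1}$ even integral (so $cG^{ -1}\mathbb{Z}^n\subseteq\mathbb{Z}^n$ when $N\mid c$). For a subset $S\subseteq\mathbb{Z}^n/c\mathbb{Z}^n$, $\mathfrak{G}^S_G(a/c;\mathbf{w})=\sum_{\mathbf{v}\in S}e\big(\frac ac\cdot\frac12(\mathbf{v}+\mathbf{w})^TG(\mathbf{v}+\mathbf{w})\big)$ with $\mathbf v$ over integer representatives (independent of choice since $G\mathbf w\in\mathbb{Z}^n$). -}

module Defs where

open import Level using (Level; _⊔_)
open import Data.Nat as ℕ using (ℕ; zero; suc; NonZero)
open import Data.Integer as ℤ using (ℤ; +_)
open import Data.Rational as ℚ using (ℚ; _/_; ½)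
open import Data.Fin using (Fin)
open import Data.List using (List; []; _∷_; map; concatMap; foldr; filter)
open import Data.Vec.Functional using (Vector) renaming (_∷_ to _∷ᵛ_)
open import Data.Product using (Σ; ∃; _×_; _,_)
open import Data.Sum using (_⊎_)
open import Relation.Nullary using (¬_)
open import Relation.Unary using (Pred; Decidable)
open import Relation.Binary.PropositionalEquality using (_≡_)
open import Algebra.Bundles using (CommutativeRing)

ι : ℤ → ℚ
ι z = z / 1

IsInt : ℚ → Set
IsInt r = ∃ λ (z : ℤ) → r ≡ ι z

Σℤ : (n : ℕ) → (Fin n → ℤ) → ℤ
Σℤ zero    f = + 0
Σℤ (suc n) f = f Fin.zero ℤ.+ Σℤ n (λ i → f (Fin.suc i))
  where import Data.Fin as Fin

Σℚ : (n : ℕ) → (Fin n → ℚ) → ℚ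
Σℚ zero    f = ℚ.0ℚ
Σℚ (suc n) f = f Fin.zero ℚ.+ Σℚ n (λ i → f (Fin.suc i))
  where import Data.Fin as Fin

IntMat : ℕ → Set
IntMat n = Fin n → Fin n → ℤ

RatMat : ℕ → Set
RatMat n = Fin n → Fin n → ℚ

toℚMat : {n : ℕ} → IntMat n → RatMat n
toℚMat G i j = ι (G i j)

_⊗_ : {n : ℕ} → RatMat n → RatMat n → RatMat n
_⊗_ {n} A B i j = Σℚ n (λ k → A i k ℚ.* B k j)

Idℚ : {n : ℕ} → RatMat n
Idℚ i j with i Data.Fin.≟ j
  where import Data.Fin
... | Relation.Nullary.yes _ = ℚ.1ℚ
  where import Relation.Nullary
... | Relation.Nullary.no _  = ℚ.0ℚ
  where import Relation.Nullary

_·ᵛ_ : {n : ℕ} → RatMat n → (Fin n → ℚ) → (Fin n → ℚ)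
_·ᵛ_ {n} A x i = Σℚ n (λ j → A i j ℚ.* x j)

_·ℤ_ : {n : ℕ} → RatMat n → (Fin n → ℤ) → (Fin n → ℚ)
A ·ℤ u = A ·ᵛ (λ j → ι (u j))

quadℚ : {n : ℕ} → IntMat n → (Fin n → ℚ) → ℚ
quadℚ {n} G x = Σℚ n (λ i → Σℚ n (λ j → x i ℚ.* (ι (G i j) ℚ.* x j)))

quadℤ : {n : ℕ} → IntMat n → (Fin n → ℤ) → ℤ
quadℤ {n} G x = Σℤ n (λ i → Σℤ n (λ j → x i ℤ.* (G i j ℤ.* x j)))

Symmetric : {n : ℕ} → IntMat n → Set
Symmetric G = ∀ i j → G i j ≡ G j i

PositiveDefinite : {n : ℕ} → IntMat n → Set
PositiveDefinite G = ∀ x → ¬ (∀ i → x i ≡ + 0) → + 0 ℤ.< quadℤ G x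

EvenIntegral : {n : ℕ} → IntMat n → Set
EvenIntegral G = Symmetric G × (∀ i → ∃ λ k → G i i ≡ (+ 2) ℤ.* k)

EvenIntegralℚ : {n : ℕ} → RatMat n → Set
EvenIntegralℚ A = (∀ i j → IsInt (A i j)) × (∀ i j → A i j ≡ A j i)
                × (∀ i → ∃ λ k → A i i ≡ ι ((+ 2) ℤ.* k))

scaleMat : {n : ℕ} → ℕ → RatMat n → RatMat n
scaleMat m A i j = ι (+ m) ℚ.* A i j

IsInverse : {n : ℕ} → IntMat n → RatMat n → Set
IsInverse G Ginv = (∀ i j → (toℚMat G ⊗ Ginv) i j ≡ Idℚ i j)
                 × (∀ i j → (Ginv ⊗ toℚMat G) i j ≡ Idℚ i j)

IsLevel : {n : ℕ} → RatMat n → ℕ → Set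
IsLevel Ginv N = (0 ℕ.< N) × EvenIntegralℚ (scaleMat N Ginv)
               × (∀ M → 0 ℕ.< M → EvenIntegralℚ (scaleMat M Ginv) → N ℕ.≤ M)

-- Subsets of ℤⁿ/cℤⁿ, represented as predicates on ℤⁿ invariant mod c

CongMod : {n : ℕ} → ℕ → (Fin n → ℤ) → (Fin n → ℤ) → Set
CongMod {n} c v v' = ∃ λ (k : Fin n → ℤ) → ∀ i → v' i ≡ v i ℤ.+ (+ c) ℤ.* k i

InvariantMod : {n : ℕ} → ℕ → Pred (Fin n → ℤ) Level.zero → Set
InvariantMod c P = ∀ v v' → CongMod c v v' → P v → P v'

IsSubgroupMod : {n : ℕ} → ℕ → Pred (Fin n → ℤ) Level.zero → Set
IsSubgroupMod c P = InvariantMod c P × P (λ _ → + 0)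
                  × (∀ v v' → P v → P v' → P (λ i → v i ℤ.+ v' i))
                  × (∀ v → P v → P (λ i → ℤ.- v i))

ContainsCGinv : {n : ℕ} → ℕ → RatMat n → Pred (Fin n → ℤ) Level.zero → Set
ContainsCGinv {n} c Ginv P =
  ∀ (u y : Fin n → ℤ) → (∀ i → ι (y i) ≡ ι (+ c) ℚ.* (Ginv ·ℤ u) i) → P y

S[_,_,_] : {n : ℕ} → ℕ → RatMat n → (Fin n → ℤ) → Pred (Fin n → ℤ) Level.zero
S[_,_,_] {n} c Ginv x v = ∃ λ (y : Fin n → ℤ) → CongMod c v y ×
  (∃ λ (u : Fin n → ℤ) → ∀ i → ι (y i) ≡ ι (x i) ℚ.+ ι (+ c) ℚ.* (Ginv ·ℤ u) i)

-- Representatives {0,…,c-1}ⁿ of ℤⁿ/cℤⁿ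

box : (n c : ℕ) → List (Fin n → ℤ)
box zero    c = (λ ()) ∷ []
box (suc n) c = concatMap (λ k → map (λ v → (+ Data.Fin.toℕ k) ∷ᵛ v) (box n c))
                          (Data.List.allFin c)
  where import Data.Fin
        import Data.List

record IsIntegralDomain {c ℓ : Level} (R : CommutativeRing c ℓ) : Set (c ⊔ ℓ) where
  open CommutativeRing R
  field
    nontrivial   : ¬ (1# ≈ 0#)
    noZeroDivisors : ∀ x y → x * y ≈ 0# → x ≈ 0# ⊎ y ≈ 0#

-- e : ℚ → R is an injective character of ℚ/ℤ into R^×:
-- e(r + s) = e(r) e(s), and e(r) = 1 exactly when r ∈ ℤ.
-- (r ↦ exp(2πi r) on ℚ → ℂ is such a map.)
record IsExp {c ℓ : Level} (R : CommutativeRing c ℓ) (e : ℚ → CommutativeRing.Carrier R)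
             : Set (c ⊔ ℓ) where
  open CommutativeRing R
  field
    hom    : ∀ r s → e (r ℚ.+ s) ≈ e r * e s
    one⇒int : ∀ r → e r ≈ 1# → IsInt r
    int⇒one : ∀ r → IsInt r → e r ≈ 1#

GaussSum : {c ℓ : Level} (R : CommutativeRing c ℓ) (e : ℚ → CommutativeRing.Carrier R)
           {n : ℕ} (G : IntMat n) (a : ℤ) (cc : ℕ) .{{_ : NonZero cc}}
           (w : Fin n → ℚ) (S : Pred (Fin n → ℤ) Level.zero) (dec : Decidable S)
           → CommutativeRing.Carrier R
GaussSum R e {n} G a cc w S dec =
  foldr _+_ 0# (map term (filter dec (box n cc)))
  where
    open CommutativeRing R
    term : (Fin n → ℤ) → Carrier
    term v = e ((a / cc) ℚ.* (½ ℚ.* quadℚ G (λ i → ι (v i) ℚ.+ w i)))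

{-# OPTIONS --safe #-}
module Submission where

-- Write 𝔊 for the Gauss sum and t(v) = e((a/c)·½(v+w)ᵀG(v+w)) for its summand. Since G is
-- even and Gw = u is integral, t is well defined modulo c: translating v by ck multiplies t(v)
-- by e(a(kᵀG(v+w) + c·½kᵀGk)) = 1. Since N ∣ c, the vector zᵢ = cG⁻¹eᵢ is integral, and
-- expanding the form gives t(v + zᵢ) = e(a wᵢ) t(v), because a(vᵢ + c·½(G⁻¹)ᵢᵢ) ∈ ℤ.
-- H and S_x are unions of classes mod c that are stable under translation by zᵢ, so
-- translating the summation variable gives 𝔊 = e(a wᵢ) 𝔊. For an i with a wᵢ ∉ ℤ we
-- have e(a wᵢ) ≠ 1, hence 𝔊 = 0 in the integral domain R.

open import Defs

open import Level using (Level; 0ℓ)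
open import Function using (_∘_; id)
open import Data.Empty using (⊥-elim)
open import Data.Product using (∃; _×_; _,_; proj₁; proj₂)
open import Data.Sum as Sum using (_⊎_; inj₁; inj₂)
open import Data.Maybe using (nothing)
open import Data.Nat as ℕ using (ℕ; zero; suc; NonZero; _≤_)
open import Data.Nat.Divisibility using (_∣_; divides)
import Data.Nat.Properties as ℕₚ
open import Data.Integer as ℤ using (ℤ; +_; -[1+_])
open import Data.Integer.GCD using (gcd)
import Data.Integer.Properties as ℤₚ
import Data.Integer.Tactic.RingSolver as ℤ-Solver
open import Data.Rational as ℚ using (ℚ; _/_; ½; 0ℚ; 1ℚ; toℚᵘ)
import Data.Rational.Properties as ℚₚ
import Data.Rational.Unnormalised as ℚᵘ
import Data.Rational.Unnormalised.Properties as ℚᵘₚ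
open import Data.Fin as Fin using (Fin; zero; suc; toℕ)
import Data.Fin.Properties as Finₚ
open import Data.List using (List; []; _∷_; _++_; map; foldr; concatMap; tabulate; allFin; filter)
open import Data.Vec.Functional using () renaming (_∷_ to _∷ᵛ_)
open import Relation.Nullary using (¬_; yes; no)
open import Relation.Unary using (Pred; Decidable)
open import Relation.Binary.PropositionalEquality
  using (_≡_; _≢_; refl; sym; trans; cong; cong₂; subst; module ≡-Reasoning)
open import Algebra.Bundles using (CommutativeMonoid; CommutativeRing)
import Algebra.Properties.CommutativeSemigroup
  (CommutativeMonoid.commutativeSemigroup ℚₚ.+-0-commutativeMonoid) as ℚ+
import Algebra.Properties.CommutativeSemigroup
  (CommutativeMonoid.commutativeSemigroup ℚₚ.*-1-commutativeMonoid) as ℚ*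
import Algebra.Properties.Semiring.Sum (CommutativeRing.semiring ℚₚ.+-*-commutativeRing) as ℚΣ
import Tactic.RingSolver as RingSolver
import Tactic.RingSolver.Core.AlmostCommutativeRing as ACR

toℚᵘ-ι : ∀ z → toℚᵘ (ι z) ℚᵘ.≃ ℚᵘ.mkℚᵘ z 0
toℚᵘ-ι z = ℚₚ.toℚᵘ-fromℚᵘ (ℚᵘ.mkℚᵘ z 0)

ι-homo-+ : ∀ x y → ι (x ℤ.+ y) ≡ ι x ℚ.+ ι y
ι-homo-+ x y = ℚₚ.toℚᵘ-injective (begin
  toℚᵘ (ι (x ℤ.+ y))            ≈⟨ toℚᵘ-ι (x ℤ.+ y) ⟩
  ℚᵘ.mkℚᵘ (x ℤ.+ y) 0           ≈⟨ ℚᵘ.*≡* (over-1 x y) ⟩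
  ℚᵘ.mkℚᵘ x 0 ℚᵘ.+ ℚᵘ.mkℚᵘ y 0  ≈⟨ ℚᵘₚ.+-cong (toℚᵘ-ι x) (toℚᵘ-ι y) ⟨
  toℚᵘ (ι x) ℚᵘ.+ toℚᵘ (ι y)    ≈⟨ ℚₚ.toℚᵘ-homo-+ (ι x) (ι y) ⟨
  toℚᵘ (ι x ℚ.+ ι y)            ∎)
  where
  open ℚᵘₚ.≃-Reasoning
  over-1 : ∀ x y → (x ℤ.+ y) ℤ.* + 1 ≡ (x ℤ.* + 1 ℤ.+ y ℤ.* + 1) ℤ.* + 1
  over-1 = ℤ-Solver.solve-∀

ι-homo-* : ∀ x y → ι (x ℤ.* y) ≡ ι x ℚ.* ι y
ι-homo-* x y = ℚₚ.toℚᵘ-injective (begin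
  toℚᵘ (ι (x ℤ.* y))            ≈⟨ toℚᵘ-ι (x ℤ.* y) ⟩
  ℚᵘ.mkℚᵘ x 0 ℚᵘ.* ℚᵘ.mkℚᵘ y 0  ≈⟨ ℚᵘₚ.*-cong (toℚᵘ-ι x) (toℚᵘ-ι y) ⟨
  toℚᵘ (ι x) ℚᵘ.* toℚᵘ (ι y)    ≈⟨ ℚₚ.toℚᵘ-homo-* (ι x) (ι y) ⟨
  toℚᵘ (ι x ℚ.* ι y)            ∎)
  where open ℚᵘₚ.≃-Reasoning

ι-homo‿- : ∀ x → ι (ℤ.- x) ≡ ℚ.- ι x
ι-homo‿- x = ℚₚ.toℚᵘ-injective (begin
  toℚᵘ (ι (ℤ.- x))  ≈⟨ toℚᵘ-ι (ℤ.- x) ⟩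
  ℚᵘ.- ℚᵘ.mkℚᵘ x 0  ≈⟨ ℚᵘₚ.-‿cong (toℚᵘ-ι x) ⟨
  ℚᵘ.- toℚᵘ (ι x)   ≈⟨ ℚₚ.toℚᵘ-homo‿- (ι x) ⟨
  toℚᵘ (ℚ.- ι x)    ∎)
  where open ℚᵘₚ.≃-Reasoning

i/n*n≡i : ∀ i n .{{_ : NonZero n}} → (i / n) ℚ.* ι (+ n) ≡ ι i
i/n*n≡i i n@(suc m) = ℚₚ.toℚᵘ-injective (begin
  toℚᵘ ((i / n) ℚ.* ι (+ n))        ≈⟨ ℚₚ.toℚᵘ-homo-* (i / n) (ι (+ n)) ⟩
  toℚᵘ (i / n) ℚᵘ.* toℚᵘ (ι (+ n))  ≈⟨ ℚᵘₚ.*-cong (ℚₚ.toℚᵘ-fromℚᵘ (ℚᵘ.mkℚᵘ i m)) (toℚᵘ-ι (+ n)) ⟩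
  ℚᵘ.mkℚᵘ i m ℚᵘ.* ℚᵘ.mkℚᵘ (+ n) 0  ≈⟨ ℚᵘ.*≡* cancel ⟩
  ℚᵘ.mkℚᵘ i 0                       ≈⟨ toℚᵘ-ι i ⟨
  toℚᵘ (ι i)                        ∎)
  where
  open ℚᵘₚ.≃-Reasoning
  cancel : (i ℤ.* + n) ℤ.* + 1 ≡ i ℤ.* + (n ℕ.* 1)
  cancel rewrite ℕₚ.*-identityʳ n = ℤₚ.*-identityʳ _

½*ι[2k]≡ι[k] : ∀ k → ½ ℚ.* ι (+ 2 ℤ.* k) ≡ ι k
½*ι[2k]≡ι[k] k = begin
  ½ ℚ.* ι (+ 2 ℤ.* k)      ≡⟨ cong (½ ℚ.*_) (ι-homo-* (+ 2) k) ⟩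
  ½ ℚ.* (ι (+ 2) ℚ.* ι k)  ≡⟨ ℚₚ.*-assoc ½ (ι (+ 2)) (ι k) ⟨
  1ℚ ℚ.* ι k               ≡⟨ ℚₚ.*-identityˡ (ι k) ⟩
  ι k                      ∎
  where open ≡-Reasoning

IsInt-+ : ∀ {p q} → IsInt p → IsInt q → IsInt (p ℚ.+ q)
IsInt-+ (x , refl) (y , refl) = x ℤ.+ y , sym (ι-homo-+ x y)

IsInt-* : ∀ {p q} → IsInt p → IsInt q → IsInt (p ℚ.* q)
IsInt-* (x , refl) (y , refl) = x ℤ.* y , sym (ι-homo-* x y)

IsInt-Σℚ : ∀ n {f : Fin n → ℚ} → (∀ i → IsInt (f i)) → IsInt (Σℚ n f)
IsInt-Σℚ zero    _    = + 0 , refl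
IsInt-Σℚ (suc n) ints = IsInt-+ (ints zero) (IsInt-Σℚ n (ints ∘ suc))

Σℚ≡sum : ∀ n (f : Fin n → ℚ) → Σℚ n f ≡ ℚΣ.sum f
Σℚ≡sum zero    f = refl
Σℚ≡sum (suc n) f = cong (f zero ℚ.+_) (Σℚ≡sum n (f ∘ suc))

Σℚ-cong : ∀ n {f g : Fin n → ℚ} → (∀ i → f i ≡ g i) → Σℚ n f ≡ Σℚ n g
Σℚ-cong zero    f≗g = refl
Σℚ-cong (suc n) f≗g = cong₂ ℚ._+_ (f≗g zero) (Σℚ-cong n (f≗g ∘ suc))

Σℚ-zero : ∀ n → Σℚ n (λ _ → 0ℚ) ≡ 0ℚ
Σℚ-zero n = trans (Σℚ≡sum n _) (ℚΣ.sum-replicate-zero n)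

Σℚ-distrib-+ : ∀ n (f g : Fin n → ℚ) → Σℚ n (λ i → f i ℚ.+ g i) ≡ Σℚ n f ℚ.+ Σℚ n g
Σℚ-distrib-+ n f g = begin
  Σℚ n (λ i → f i ℚ.+ g i)    ≡⟨ Σℚ≡sum n _ ⟩
  ℚΣ.sum (λ i → f i ℚ.+ g i)  ≡⟨ ℚΣ.∑-distrib-+ f g ⟩
  ℚΣ.sum f ℚ.+ ℚΣ.sum g       ≡⟨ cong₂ ℚ._+_ (Σℚ≡sum n f) (Σℚ≡sum n g) ⟨
  Σℚ n f ℚ.+ Σℚ n g           ∎
  where open ≡-Reasoning

*-distribˡ-Σℚ : ∀ n r (f : Fin n → ℚ) → r ℚ.* Σℚ n f ≡ Σℚ n (λ i → r ℚ.* f i)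
*-distribˡ-Σℚ n r f = begin
  r ℚ.* Σℚ n f              ≡⟨ cong (r ℚ.*_) (Σℚ≡sum n f) ⟩
  r ℚ.* ℚΣ.sum f            ≡⟨ ℚΣ.*-distribˡ-sum r f ⟩
  ℚΣ.sum (λ i → r ℚ.* f i)  ≡⟨ Σℚ≡sum n _ ⟨
  Σℚ n (λ i → r ℚ.* f i)    ∎
  where open ≡-Reasoning

*-distribʳ-Σℚ : ∀ n r (f : Fin n → ℚ) → Σℚ n f ℚ.* r ≡ Σℚ n (λ i → f i ℚ.* r)
*-distribʳ-Σℚ n r f = begin
  Σℚ n f ℚ.* r              ≡⟨ cong (ℚ._* r) (Σℚ≡sum n f) ⟩
  ℚΣ.sum f ℚ.* r            ≡⟨ ℚΣ.*-distribʳ-sum r f ⟩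
  ℚΣ.sum (λ i → f i ℚ.* r)  ≡⟨ Σℚ≡sum n _ ⟨
  Σℚ n (λ i → f i ℚ.* r)    ∎
  where open ≡-Reasoning

neg-distrib-Σℚ : ∀ n (f : Fin n → ℚ) → ℚ.- Σℚ n f ≡ Σℚ n (λ i → ℚ.- f i)
neg-distrib-Σℚ zero    f = refl
neg-distrib-Σℚ (suc n) f =
  trans (ℚₚ.neg-distrib-+ (f zero) _) (cong (ℚ.- f zero ℚ.+_) (neg-distrib-Σℚ n (f ∘ suc)))

Σℚ-comm : ∀ m n (f : Fin m → Fin n → ℚ) →
          Σℚ m (λ i → Σℚ n (f i)) ≡ Σℚ n (λ j → Σℚ m (λ i → f i j))
Σℚ-comm m n f = begin
  Σℚ m (λ i → Σℚ n (f i))              ≡⟨ Σℚ-cong m (λ i → Σℚ≡sum n (f i)) ⟩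
  Σℚ m (λ i → ℚΣ.sum (f i))            ≡⟨ Σℚ≡sum m _ ⟩
  ℚΣ.sum (λ i → ℚΣ.sum (f i))          ≡⟨ ℚΣ.∑-comm f ⟩
  ℚΣ.sum (λ j → ℚΣ.sum (λ i → f i j))  ≡⟨ Σℚ≡sum n _ ⟨
  Σℚ n (λ j → ℚΣ.sum (λ i → f i j))    ≡⟨ Σℚ-cong n (λ j → Σℚ≡sum m (λ i → f i j)) ⟨
  Σℚ n (λ j → Σℚ m (λ i → f i j))      ∎
  where open ≡-Reasoning

δ : ∀ {n} → Fin n → Fin n → ℤ
δ zero    zero    = + 1
δ zero    (suc j) = + 0
δ (suc i) zero    = + 0
δ (suc i) (suc j) = δ i j

δ-sym : ∀ {n} (i j : Fin n) → δ i j ≡ δ j i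
δ-sym zero    zero    = refl
δ-sym zero    (suc j) = refl
δ-sym (suc i) zero    = refl
δ-sym (suc i) (suc j) = δ-sym i j

Idℚ≡δ : ∀ {n} (i j : Fin n) → Idℚ i j ≡ ι (δ i j)
Idℚ≡δ i j with i Fin.≟ j
... | yes refl = cong ι (sym (δ-refl i))
  where
  δ-refl : ∀ {n} (i : Fin n) → δ i i ≡ + 1
  δ-refl zero    = refl
  δ-refl (suc i) = δ-refl i
... | no i≢j = cong ι (sym (δ-≢ i j i≢j))
  where
  δ-≢ : ∀ {n} (i j : Fin n) → i ≢ j → δ i j ≡ + 0
  δ-≢ zero    zero    i≢j = ⊥-elim (i≢j refl)
  δ-≢ zero    (suc j) _   = refl
  δ-≢ (suc i) zero    _   = refl
  δ-≢ (suc i) (suc j) i≢j = δ-≢ i j (i≢j ∘ cong suc)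

Σℚ-δ : ∀ n (f : Fin n → ℚ) i → Σℚ n (λ k → f k ℚ.* ι (δ i k)) ≡ f i
Σℚ-δ (suc n) f zero = begin
  f zero ℚ.* 1ℚ ℚ.+ Σℚ n (λ k → f (suc k) ℚ.* 0ℚ)
    ≡⟨ cong₂ ℚ._+_ (ℚₚ.*-identityʳ (f zero)) (Σℚ-cong n (ℚₚ.*-zeroʳ ∘ f ∘ suc)) ⟩
  f zero ℚ.+ Σℚ n (λ _ → 0ℚ)
    ≡⟨ cong (f zero ℚ.+_) (Σℚ-zero n) ⟩
  f zero ℚ.+ 0ℚ
    ≡⟨ ℚₚ.+-identityʳ (f zero) ⟩
  f zero
    ∎
  where open ≡-Reasoning
Σℚ-δ (suc n) f (suc i) =
  trans (cong₂ ℚ._+_ (ℚₚ.*-zeroʳ (f zero)) (Σℚ-δ n (f ∘ suc) i)) (ℚₚ.+-identityˡ (f (suc i)))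

module _ {n : ℕ} (A : RatMat n) where

  ·ᵛ-cong : ∀ {x y : Fin n → ℚ} → (∀ j → x j ≡ y j) → ∀ i → (A ·ᵛ x) i ≡ (A ·ᵛ y) i
  ·ᵛ-cong x≗y i = Σℚ-cong n (λ j → cong (A i j ℚ.*_) (x≗y j))

  ·ᵛ-distrib-+ : ∀ (x y : Fin n → ℚ) i →
                 (A ·ᵛ (λ j → x j ℚ.+ y j)) i ≡ (A ·ᵛ x) i ℚ.+ (A ·ᵛ y) i
  ·ᵛ-distrib-+ x y i =
    trans (Σℚ-cong n (λ j → ℚₚ.*-distribˡ-+ (A i j) (x j) (y j))) (Σℚ-distrib-+ n _ _)

  ·ᵛ-neg : ∀ (x : Fin n → ℚ) i → (A ·ᵛ (λ j → ℚ.- x j)) i ≡ ℚ.- (A ·ᵛ x) i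
  ·ᵛ-neg x i =
    trans (Σℚ-cong n (λ j → sym (ℚₚ.neg-distribʳ-* (A i j) (x j)))) (sym (neg-distrib-Σℚ n _))

  ·ᵛ-assoc : ∀ (B : RatMat n) x i → ((A ⊗ B) ·ᵛ x) i ≡ (A ·ᵛ (B ·ᵛ x)) i
  ·ᵛ-assoc B x i = begin
    Σℚ n (λ j → Σℚ n (λ k → A i k ℚ.* B k j) ℚ.* x j)
      ≡⟨ Σℚ-cong n (λ j → *-distribʳ-Σℚ n (x j) _) ⟩
    Σℚ n (λ j → Σℚ n (λ k → (A i k ℚ.* B k j) ℚ.* x j))
      ≡⟨ Σℚ-comm n n _ ⟩
    Σℚ n (λ k → Σℚ n (λ j → (A i k ℚ.* B k j) ℚ.* x j))
      ≡⟨ Σℚ-cong n (λ k → Σℚ-cong n (λ j → ℚₚ.*-assoc (A i k) (B k j) (x j))) ⟩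
    Σℚ n (λ k → Σℚ n (λ j → A i k ℚ.* (B k j ℚ.* x j)))
      ≡⟨ Σℚ-cong n (λ k → *-distribˡ-Σℚ n (A i k) _) ⟨
    Σℚ n (λ k → A i k ℚ.* Σℚ n (λ j → B k j ℚ.* x j))
      ∎
    where open ≡-Reasoning

  ·ℤ-δ : ∀ j i → (A ·ℤ δ j) i ≡ A i j
  ·ℤ-δ j i = Σℚ-δ n (A i) j

  ·ℤ-+ : ∀ (u t : Fin n → ℤ) i → (A ·ℤ (λ j → u j ℤ.+ t j)) i ≡ (A ·ℤ u) i ℚ.+ (A ·ℤ t) i
  ·ℤ-+ u t i = trans (·ᵛ-cong (λ j → ι-homo-+ (u j) (t j)) i) (·ᵛ-distrib-+ _ _ i)

  ·ℤ-neg : ∀ (t : Fin n → ℤ) i → (A ·ℤ (λ j → ℤ.- t j)) i ≡ ℚ.- (A ·ℤ t) i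
  ·ℤ-neg t i = trans (·ᵛ-cong (λ j → ι-homo‿- (t j)) i) (·ᵛ-neg _ i)

Idℚ-·ᵛ : ∀ {n} (x : Fin n → ℚ) i → (Idℚ ·ᵛ x) i ≡ x i
Idℚ-·ᵛ {n} x i = begin
  Σℚ n (λ j → Idℚ i j ℚ.* x j)    ≡⟨ Σℚ-cong n Idᵢⱼxⱼ≡xⱼδᵢⱼ ⟩
  Σℚ n (λ j → x j ℚ.* ι (δ i j))  ≡⟨ Σℚ-δ n x i ⟩
  x i                             ∎
  where
  open ≡-Reasoning
  Idᵢⱼxⱼ≡xⱼδᵢⱼ : ∀ j → Idℚ i j ℚ.* x j ≡ x j ℚ.* ι (δ i j)
  Idᵢⱼxⱼ≡xⱼδᵢⱼ j = trans (cong (ℚ._* x j) (Idℚ≡δ i j)) (ℚₚ.*-comm _ (x j))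

ℚ-ring : ACR.AlmostCommutativeRing 0ℓ 0ℓ
ℚ-ring = ACR.fromCommutativeRing ℚₚ.+-*-commutativeRing (λ _ → nothing)

xᵢGᵢⱼyⱼ≡yⱼGⱼᵢxᵢ : ∀ {n} {G : IntMat n} → Symmetric G → ∀ (x y : Fin n → ℚ) i j →
                  x i ℚ.* (ι (G i j) ℚ.* y j) ≡ y j ℚ.* (ι (G j i) ℚ.* x i)
xᵢGᵢⱼyⱼ≡yⱼGⱼᵢxᵢ {G = G} G-sym x y i j =
  trans (xgy≡ygx (x i) (ι (G i j)) (y j)) (cong (λ g → y j ℚ.* (ι g ℚ.* x i)) (G-sym i j))
  where
  xgy≡ygx : ∀ x g y → x ℚ.* (g ℚ.* y) ≡ y ℚ.* (g ℚ.* x)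
  xgy≡ygx = RingSolver.solve-∀ ℚ-ring

-- Splitting off the first row and column, the two cross terms x₀G₀ⱼxⱼ and xⱼGⱼ₀x₀ coincide,
-- so only the diagonal entry is halved.
IsInt-½*quadℚ : ∀ {n} (G : IntMat n) → EvenIntegral G →
                ∀ x → (∀ i → IsInt (x i)) → IsInt (½ ℚ.* quadℚ G x)
IsInt-½*quadℚ {zero}  G _                x _     = + 0 , refl
IsInt-½*quadℚ {suc n} G (G-sym , G-even) x x-int =
  subst IsInt (sym ½quad-split)
    (IsInt-+ diagonal-integral (IsInt-+ cross-integral (IsInt-½*quadℚ G′ G′-even x′ (x-int ∘ suc))))
  where
  x₀ = x zero
  x′ = x ∘ suc
  g₀₀ = ι (G zero zero)
  k = proj₁ (G-even zero)

  G′ : IntMat n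
  G′ i j = G (suc i) (suc j)

  G′-even : EvenIntegral G′
  G′-even = (λ i j → G-sym (suc i) (suc j)) , G-even ∘ suc

  cross : ℚ
  cross = Σℚ n (λ j → x₀ ℚ.* (ι (G zero (suc j)) ℚ.* x′ j))

  diagonal-integral : IsInt (x₀ ℚ.* (ι k ℚ.* x₀))
  diagonal-integral = IsInt-* (x-int zero) (IsInt-* (k , refl) (x-int zero))

  cross-integral : IsInt cross
  cross-integral =
    IsInt-Σℚ n (λ j → IsInt-* (x-int zero) (IsInt-* (G zero (suc j) , refl) (x-int (suc j))))

  quad-split : quadℚ G x ≡ (x₀ ℚ.* (g₀₀ ℚ.* x₀) ℚ.+ cross) ℚ.+ (cross ℚ.+ quadℚ G′ x′)
  quad-split = cong (x₀ ℚ.* (g₀₀ ℚ.* x₀) ℚ.+ cross ℚ.+_)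
    (trans (Σℚ-distrib-+ n _ _)
           (cong (ℚ._+ quadℚ G′ x′) (Σℚ-cong n (λ i → xᵢGᵢⱼyⱼ≡yⱼGⱼᵢxᵢ G-sym x x (suc i) zero))))

  regroup : ∀ x₀ g r q → ½ ℚ.* ((x₀ ℚ.* (g ℚ.* x₀) ℚ.+ r) ℚ.+ (r ℚ.+ q))
                       ≡ x₀ ℚ.* ((½ ℚ.* g) ℚ.* x₀) ℚ.+ (r ℚ.+ ½ ℚ.* q)
  regroup = RingSolver.solve-∀ ℚ-ring

  ½quad-split : ½ ℚ.* quadℚ G x ≡ x₀ ℚ.* (ι k ℚ.* x₀) ℚ.+ (cross ℚ.+ ½ ℚ.* quadℚ G′ x′)
  ½quad-split = begin
    ½ ℚ.* quadℚ G x
      ≡⟨ cong (½ ℚ.*_) quad-split ⟩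
    ½ ℚ.* ((x₀ ℚ.* (g₀₀ ℚ.* x₀) ℚ.+ cross) ℚ.+ (cross ℚ.+ quadℚ G′ x′))
      ≡⟨ regroup x₀ g₀₀ cross (quadℚ G′ x′) ⟩
    x₀ ℚ.* ((½ ℚ.* g₀₀) ℚ.* x₀) ℚ.+ (cross ℚ.+ ½ ℚ.* quadℚ G′ x′)
      ≡⟨ cong (λ h → x₀ ℚ.* (h ℚ.* x₀) ℚ.+ (cross ℚ.+ ½ ℚ.* quadℚ G′ x′))
              (trans (cong (λ g → ½ ℚ.* ι g) (proj₂ (G-even zero))) (½*ι[2k]≡ι[k] k)) ⟩
    x₀ ℚ.* (ι k ℚ.* x₀) ℚ.+ (cross ℚ.+ ½ ℚ.* quadℚ G′ x′)
      ∎
    where open ≡-Reasoning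

module BilinearForm {n : ℕ} (G : IntMat n) where

  ⟪_,_⟫ : (Fin n → ℚ) → (Fin n → ℚ) → ℚ
  ⟪ x , y ⟫ = Σℚ n (λ i → x i ℚ.* (toℚMat G ·ᵛ y) i)

  quadℚ≡⟪⟫ : ∀ x → quadℚ G x ≡ ⟪ x , x ⟫
  quadℚ≡⟪⟫ x = Σℚ-cong n (λ i → sym (*-distribˡ-Σℚ n (x i) _))

  quadℚ-cong : ∀ {x y} → (∀ i → x i ≡ y i) → quadℚ G x ≡ quadℚ G y
  quadℚ-cong x≗y =
    Σℚ-cong n (λ i → Σℚ-cong n (λ j → cong₂ (λ p q → p ℚ.* (ι (G i j) ℚ.* q)) (x≗y i) (x≗y j)))

  ⟪⟫-distribˡ-+ : ∀ x x′ y → ⟪ (λ i → x i ℚ.+ x′ i) , y ⟫ ≡ ⟪ x , y ⟫ ℚ.+ ⟪ x′ , y ⟫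
  ⟪⟫-distribˡ-+ x x′ y =
    trans (Σℚ-cong n (λ i → ℚₚ.*-distribʳ-+ _ (x i) (x′ i))) (Σℚ-distrib-+ n _ _)

  ⟪⟫-distribʳ-+ : ∀ x y y′ → ⟪ x , (λ i → y i ℚ.+ y′ i) ⟫ ≡ ⟪ x , y ⟫ ℚ.+ ⟪ x , y′ ⟫
  ⟪⟫-distribʳ-+ x y y′ =
    trans (Σℚ-cong n (λ i → trans (cong (x i ℚ.*_) (·ᵛ-distrib-+ (toℚMat G) y y′ i))
                                  (ℚₚ.*-distribˡ-+ (x i) _ _)))
          (Σℚ-distrib-+ n _ _)

  ⟪⟫-*ˡ : ∀ r x y → ⟪ (λ i → r ℚ.* x i) , y ⟫ ≡ r ℚ.* ⟪ x , y ⟫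
  ⟪⟫-*ˡ r x y = trans (Σℚ-cong n (λ i → ℚₚ.*-assoc r (x i) _)) (sym (*-distribˡ-Σℚ n r _))

  ⟪⟫-comm : Symmetric G → ∀ x y → ⟪ x , y ⟫ ≡ ⟪ y , x ⟫
  ⟪⟫-comm G-sym x y = begin
    Σℚ n (λ i → x i ℚ.* Σℚ n (λ j → ι (G i j) ℚ.* y j))
      ≡⟨ Σℚ-cong n (λ i → *-distribˡ-Σℚ n (x i) _) ⟩
    Σℚ n (λ i → Σℚ n (λ j → x i ℚ.* (ι (G i j) ℚ.* y j)))
      ≡⟨ Σℚ-comm n n _ ⟩
    Σℚ n (λ j → Σℚ n (λ i → x i ℚ.* (ι (G i j) ℚ.* y j)))
      ≡⟨ Σℚ-cong n (λ j → Σℚ-cong n (λ i → xᵢGᵢⱼyⱼ≡yⱼGⱼᵢxᵢ G-sym x y i j)) ⟩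
    Σℚ n (λ j → Σℚ n (λ i → y j ℚ.* (ι (G j i) ℚ.* x i)))
      ≡⟨ Σℚ-cong n (λ j → *-distribˡ-Σℚ n (y j) _) ⟨
    Σℚ n (λ j → y j ℚ.* Σℚ n (λ i → ι (G j i) ℚ.* x i))
      ∎
    where open ≡-Reasoning

  ⟪Ginvᵢ,x⟫≡xᵢ : Symmetric G → ∀ {Ginv} → IsInverse G Ginv → ∀ i x → ⟪ (λ k → Ginv k i) , x ⟫ ≡ x i
  ⟪Ginvᵢ,x⟫≡xᵢ G-sym {Ginv} (GGinv≡I , _) i x = begin
    ⟪ (λ k → Ginv k i) , x ⟫                   ≡⟨ ⟪⟫-comm G-sym _ x ⟩
    Σℚ n (λ k → x k ℚ.* (toℚMat G ⊗ Ginv) k i)  ≡⟨ Σℚ-cong n (λ k → cong (x k ℚ.*_) (GGinv≡I k i)) ⟩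
    Σℚ n (λ k → x k ℚ.* Idℚ k i)               ≡⟨ Σℚ-cong n (λ k → cong (x k ℚ.*_) Idₖᵢ≡δᵢₖ) ⟩
    Σℚ n (λ k → x k ℚ.* ι (δ i k))             ≡⟨ Σℚ-δ n x i ⟩
    x i                                        ∎
    where
    open ≡-Reasoning
    Idₖᵢ≡δᵢₖ : ∀ {k} → Idℚ k i ≡ ι (δ i k)
    Idₖᵢ≡δᵢₖ {k} = trans (Idℚ≡δ k i) (cong ι (δ-sym k i))

  G·[Ginv·u]≡u : ∀ {Ginv} → IsInverse G Ginv → ∀ u i → (toℚMat G ·ᵛ (Ginv ·ℤ u)) i ≡ ι (u i)
  G·[Ginv·u]≡u {Ginv} (GGinv≡I , _) u i = begin
    (toℚMat G ·ᵛ (Ginv ·ℤ u)) i  ≡⟨ ·ᵛ-assoc (toℚMat G) Ginv _ i ⟨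
    ((toℚMat G ⊗ Ginv) ·ℤ u) i   ≡⟨ Σℚ-cong n (λ j → cong (ℚ._* ι (u j)) (GGinv≡I i j)) ⟩
    (Idℚ ·ℤ u) i                 ≡⟨ Idℚ-·ᵛ _ i ⟩
    ι (u i)                      ∎
    where open ≡-Reasoning

  quadℚ-+ : Symmetric G → ∀ x d →
            quadℚ G (λ i → x i ℚ.+ d i) ≡ quadℚ G x ℚ.+ (⟪ d , x ⟫ ℚ.+ ⟪ d , x ⟫) ℚ.+ quadℚ G d
  quadℚ-+ G-sym x d = begin
    quadℚ G x+d
      ≡⟨ quadℚ≡⟪⟫ x+d ⟩
    ⟪ x+d , x+d ⟫
      ≡⟨ ⟪⟫-distribˡ-+ x d x+d ⟩
    ⟪ x , x+d ⟫ ℚ.+ ⟪ d , x+d ⟫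
      ≡⟨ cong₂ ℚ._+_ (⟪⟫-distribʳ-+ x x d) (⟪⟫-distribʳ-+ d x d) ⟩
    (⟪ x , x ⟫ ℚ.+ ⟪ x , d ⟫) ℚ.+ (⟪ d , x ⟫ ℚ.+ ⟪ d , d ⟫)
      ≡⟨ cong (λ b → (⟪ x , x ⟫ ℚ.+ b) ℚ.+ (⟪ d , x ⟫ ℚ.+ ⟪ d , d ⟫)) (⟪⟫-comm G-sym x d) ⟩
    (⟪ x , x ⟫ ℚ.+ ⟪ d , x ⟫) ℚ.+ (⟪ d , x ⟫ ℚ.+ ⟪ d , d ⟫)
      ≡⟨ regroup ⟪ x , x ⟫ ⟪ d , x ⟫ ⟪ d , d ⟫ ⟩
    ⟪ x , x ⟫ ℚ.+ (⟪ d , x ⟫ ℚ.+ ⟪ d , x ⟫) ℚ.+ ⟪ d , d ⟫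
      ≡⟨ cong₂ (λ p q → p ℚ.+ (⟪ d , x ⟫ ℚ.+ ⟪ d , x ⟫) ℚ.+ q) (quadℚ≡⟪⟫ x) (quadℚ≡⟪⟫ d) ⟨
    quadℚ G x ℚ.+ (⟪ d , x ⟫ ℚ.+ ⟪ d , x ⟫) ℚ.+ quadℚ G d
      ∎
    where
    open ≡-Reasoning
    x+d = λ i → x i ℚ.+ d i
    regroup : ∀ p b q → (p ℚ.+ b) ℚ.+ (b ℚ.+ q) ≡ p ℚ.+ (b ℚ.+ b) ℚ.+ q
    regroup = RingSolver.solve-∀ ℚ-ring

  quadℚ-* : Symmetric G → ∀ r x → quadℚ G (λ i → r ℚ.* x i) ≡ r ℚ.* (r ℚ.* quadℚ G x)
  quadℚ-* G-sym r x = begin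
    quadℚ G rx               ≡⟨ quadℚ≡⟪⟫ rx ⟩
    ⟪ rx , rx ⟫              ≡⟨ ⟪⟫-*ˡ r x rx ⟩
    r ℚ.* ⟪ x , rx ⟫         ≡⟨ cong (r ℚ.*_) (trans (⟪⟫-comm G-sym x rx) (⟪⟫-*ˡ r x x)) ⟩
    r ℚ.* (r ℚ.* ⟪ x , x ⟫)  ≡⟨ cong (λ q → r ℚ.* (r ℚ.* q)) (quadℚ≡⟪⟫ x) ⟨
    r ℚ.* (r ℚ.* quadℚ G x)  ∎
    where
    open ≡-Reasoning
    rx = λ i → r ℚ.* x i

  quadℚ-translate : Symmetric G → ∀ a c .{{_ : NonZero c}} x y →
    (a / c) ℚ.* (½ ℚ.* quadℚ G (λ i → x i ℚ.+ ι (+ c) ℚ.* y i))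
      ≡ (a / c) ℚ.* (½ ℚ.* quadℚ G x) ℚ.+ ι a ℚ.* (⟪ y , x ⟫ ℚ.+ ι (+ c) ℚ.* (½ ℚ.* quadℚ G y))
  quadℚ-translate G-sym a c x y = begin
    a/c ℚ.* (½ ℚ.* quadℚ G (λ i → x i ℚ.+ κ ℚ.* y i))
      ≡⟨ cong (λ q → a/c ℚ.* (½ ℚ.* q)) (quadℚ-+ G-sym x κy) ⟩
    a/c ℚ.* (½ ℚ.* (quadℚ G x ℚ.+ (⟪ κy , x ⟫ ℚ.+ ⟪ κy , x ⟫) ℚ.+ quadℚ G κy))
      ≡⟨ cong₂ (λ b q → a/c ℚ.* (½ ℚ.* (quadℚ G x ℚ.+ (b ℚ.+ b) ℚ.+ q)))
               (⟪⟫-*ˡ κ y x) (quadℚ-* G-sym κ y) ⟩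
    a/c ℚ.* (½ ℚ.* (quadℚ G x ℚ.+ (κ ℚ.* ⟪ y , x ⟫ ℚ.+ κ ℚ.* ⟪ y , x ⟫) ℚ.+ κ ℚ.* (κ ℚ.* quadℚ G y)))
      ≡⟨ regroup a/c κ (quadℚ G x) ⟪ y , x ⟫ (quadℚ G y) ⟩
    a/c ℚ.* (½ ℚ.* quadℚ G x) ℚ.+ (a/c ℚ.* κ) ℚ.* (⟪ y , x ⟫ ℚ.+ κ ℚ.* (½ ℚ.* quadℚ G y))
      ≡⟨ cong (λ t → a/c ℚ.* (½ ℚ.* quadℚ G x) ℚ.+ t ℚ.* (⟪ y , x ⟫ ℚ.+ κ ℚ.* (½ ℚ.* quadℚ G y)))
              (i/n*n≡i a c) ⟩
    a/c ℚ.* (½ ℚ.* quadℚ G x) ℚ.+ ι a ℚ.* (⟪ y , x ⟫ ℚ.+ κ ℚ.* (½ ℚ.* quadℚ G y))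
      ∎
    where
    open ≡-Reasoning
    a/c = a / c
    κ = ι (+ c)
    κy = λ i → κ ℚ.* y i
    regroup : ∀ A k q b s → A ℚ.* (½ ℚ.* (q ℚ.+ (k ℚ.* b ℚ.+ k ℚ.* b) ℚ.+ k ℚ.* (k ℚ.* s)))
                          ≡ A ℚ.* (½ ℚ.* q) ℚ.+ (A ℚ.* k) ℚ.* (b ℚ.+ k ℚ.* (½ ℚ.* s))
    regroup = RingSolver.solve-∀ ℚ-ring

scaleMat-* : ∀ {n} (A : RatMat n) q N i j → scaleMat (q ℕ.* N) A i j ≡ ι (+ q) ℚ.* scaleMat N A i j
scaleMat-* A q N i j =
  trans (cong (ℚ._* A i j) (trans (cong ι (ℤₚ.pos-* q N)) (ι-homo-* (+ q) (+ N))))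
        (ℚₚ.*-assoc (ι (+ q)) (ι (+ N)) (A i j))

EvenIntegralℚ-scaleMat-∣ : ∀ {n} {A : RatMat n} {N c} → N ∣ c →
                           EvenIntegralℚ (scaleMat N A) → EvenIntegralℚ (scaleMat c A)
EvenIntegralℚ-scaleMat-∣ {A = A} {N} (divides q refl) (NA-int , NA-sym , NA-even) =
  (λ i j → subst IsInt (sym (scaleMat-* A q N i j)) (IsInt-* (+ q , refl) (NA-int i j))) ,
  (λ i j → trans (scaleMat-* A q N i j)
                 (trans (cong (ι (+ q) ℚ.*_) (NA-sym i j)) (sym (scaleMat-* A q N j i)))) ,
  (λ i → + q ℤ.* proj₁ (NA-even i) , qNAᵢᵢ≡2qk i)
  where
  open ≡-Reasoning
  x[yz]≡y[xz] : ∀ x y z → x ℤ.* (y ℤ.* z) ≡ y ℤ.* (x ℤ.* z)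
  x[yz]≡y[xz] = ℤ-Solver.solve-∀

  qNAᵢᵢ≡2qk : ∀ i → scaleMat (q ℕ.* N) A i i ≡ ι (+ 2 ℤ.* (+ q ℤ.* proj₁ (NA-even i)))
  qNAᵢᵢ≡2qk i = begin
    scaleMat (q ℕ.* N) A i i      ≡⟨ scaleMat-* A q N i i ⟩
    ι (+ q) ℚ.* scaleMat N A i i  ≡⟨ cong (ι (+ q) ℚ.*_) (proj₂ (NA-even i)) ⟩
    ι (+ q) ℚ.* ι (+ 2 ℤ.* k)     ≡⟨ ι-homo-* (+ q) _ ⟨
    ι (+ q ℤ.* (+ 2 ℤ.* k))       ≡⟨ cong ι (x[yz]≡y[xz] (+ q) (+ 2) k) ⟩
    ι (+ 2 ℤ.* (+ q ℤ.* k))       ∎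
    where k = proj₁ (NA-even i)

IsInt-c*½*diag : ∀ {n} {A : RatMat n} c → EvenIntegralℚ (scaleMat c A) →
                 ∀ i → IsInt (ι (+ c) ℚ.* (½ ℚ.* A i i))
IsInt-c*½*diag {A = A} c (_ , _ , cA-even) i = k , (begin
  ι (+ c) ℚ.* (½ ℚ.* A i i)  ≡⟨ ℚ*.x∙yz≈y∙xz (ι (+ c)) ½ (A i i) ⟩
  ½ ℚ.* scaleMat c A i i     ≡⟨ cong (½ ℚ.*_) (proj₂ (cA-even i)) ⟩
  ½ ℚ.* ι (+ 2 ℤ.* k)        ≡⟨ ½*ι[2k]≡ι[k] k ⟩
  ι k                        ∎)
  where
  open ≡-Reasoning
  k = proj₁ (cA-even i)

infixl 6 _+ᶻ_
_+ᶻ_ : ∀ {n} → (Fin n → ℤ) → (Fin n → ℤ) → (Fin n → ℤ)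
(v +ᶻ z) i = v i ℤ.+ z i

module CongModProperties (c : ℕ) {n : ℕ} where

  m≡m+c*0 : ∀ m → m ≡ m ℤ.+ + c ℤ.* + 0
  m≡m+c*0 m = sym (trans (cong (ℤ._+_ m) (ℤₚ.*-zeroʳ (+ c))) (ℤₚ.+-identityʳ m))

  ≗⇒CongMod : ∀ (v v′ : Fin n → ℤ) → (∀ i → v i ≡ v′ i) → CongMod c v v′
  ≗⇒CongMod v v′ v≗v′ = (λ _ → + 0) , (λ i → trans (sym (v≗v′ i)) (m≡m+c*0 (v i)))

  CongMod-sym : ∀ (v v′ : Fin n → ℤ) → CongMod c v v′ → CongMod c v′ v
  CongMod-sym v v′ (k , v′≡v+ck) =
    (λ i → ℤ.- k i) ,
    (λ i → trans (x≡[x+yz]+y[-z] (v i) (+ c) (k i)) (cong (ℤ._+ + c ℤ.* ℤ.- k i) (sym (v′≡v+ck i))))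
    where
    x≡[x+yz]+y[-z] : ∀ x y z → x ≡ (x ℤ.+ y ℤ.* z) ℤ.+ y ℤ.* ℤ.- z
    x≡[x+yz]+y[-z] = ℤ-Solver.solve-∀

  CongMod-trans : ∀ (v v′ v″ : Fin n → ℤ) → CongMod c v v′ → CongMod c v′ v″ → CongMod c v v″
  CongMod-trans v v′ v″ (k , v′≡v+ck) (k′ , v″≡v′+ck′) =
    (λ i → k i ℤ.+ k′ i) ,
    (λ i → trans (v″≡v′+ck′ i)
                 (trans (cong (ℤ._+ + c ℤ.* k′ i) (v′≡v+ck i)) (regroup (v i) (+ c) (k i) (k′ i))))
    where
    regroup : ∀ x y k k′ → (x ℤ.+ y ℤ.* k) ℤ.+ y ℤ.* k′ ≡ x ℤ.+ y ℤ.* (k ℤ.+ k′)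
    regroup = ℤ-Solver.solve-∀

  CongMod-+ᶻ : ∀ (v v′ z : Fin n → ℤ) → CongMod c v v′ → CongMod c (v +ᶻ z) (v′ +ᶻ z)
  CongMod-+ᶻ v v′ z (k , v′≡v+ck) =
    k , (λ i → trans (cong (ℤ._+ z i) (v′≡v+ck i)) (regroup (v i) (+ c) (k i) (z i)))
    where
    regroup : ∀ x y k z → (x ℤ.+ y ℤ.* k) ℤ.+ z ≡ (x ℤ.+ z) ℤ.+ y ℤ.* k
    regroup = ℤ-Solver.solve-∀

  CongMod-∷ : ∀ m (v v′ : Fin n → ℤ) → CongMod c v v′ → CongMod c (m ∷ᵛ v) (m ∷ᵛ v′)
  CongMod-∷ m v v′ (k , v′≡v+ck) = (+ 0 ∷ᵛ k) , λ
    { zero    → m≡m+c*0 m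
    ; (suc i) → v′≡v+ck i }

  CongMod-+c∷ : ∀ m (v : Fin n → ℤ) → CongMod c (m ∷ᵛ v) ((m ℤ.+ + c) ∷ᵛ v)
  CongMod-+c∷ m v = (+ 1 ∷ᵛ (λ _ → + 0)) , λ
    { zero    → cong (ℤ._+_ m) (sym (ℤₚ.*-identityʳ (+ c)))
    ; (suc i) → m≡m+c*0 (v i) }

module SumOverBox {a ℓ} (M : CommutativeMonoid a ℓ) where

  open CommutativeMonoid M
    renaming (_∙_ to _+_; ε to 0#; ∙-cong to +-cong; ∙-congʳ to +-congʳ; ∙-congˡ to +-congˡ;
              identityˡ to +-identityˡ; assoc to +-assoc; comm to +-comm;
              refl to ≈-refl; sym to ≈-sym; trans to ≈-trans)
  open import Algebra.Properties.CommutativeMonoid.Sum M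
    using (sum; sum-cong-≋; sum-cong-≗; sum-init-last)
  open import Relation.Binary.Reasoning.Setoid setoid

  ΣL : {A : Set} → List A → (A → Carrier) → Carrier
  ΣL xs f = foldr _+_ 0# (map f xs)

  ΣL-cong : ∀ {A : Set} (xs : List A) {f g : A → Carrier} → (∀ x → f x ≈ g x) → ΣL xs f ≈ ΣL xs g
  ΣL-cong []       f≈g = ≈-refl
  ΣL-cong (x ∷ xs) f≈g = +-cong (f≈g x) (ΣL-cong xs f≈g)

  ΣL-++ : ∀ {A : Set} (xs ys : List A) (f : A → Carrier) → ΣL (xs ++ ys) f ≈ ΣL xs f + ΣL ys f
  ΣL-++ []       ys f = ≈-sym (+-identityˡ _)
  ΣL-++ (x ∷ xs) ys f = ≈-trans (+-congˡ (ΣL-++ xs ys f)) (≈-sym (+-assoc _ _ _))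

  ΣL-map : ∀ {A B : Set} (h : A → B) (xs : List A) (f : B → Carrier) → ΣL (map h xs) f ≡ ΣL xs (f ∘ h)
  ΣL-map h []       f = refl
  ΣL-map h (x ∷ xs) f = cong (_+_ (f (h x))) (ΣL-map h xs f)

  ΣL-concatMap : ∀ {A B : Set} (h : A → List B) (xs : List A) (f : B → Carrier) →
                 ΣL (concatMap h xs) f ≈ ΣL xs (λ x → ΣL (h x) f)
  ΣL-concatMap h []       f = ≈-refl
  ΣL-concatMap h (x ∷ xs) f =
    ≈-trans (ΣL-++ (h x) (concatMap h xs) f) (+-congˡ (ΣL-concatMap h xs f))

  ΣL-tabulate : ∀ {A : Set} {m} (g : Fin m → A) (f : A → Carrier) → ΣL (tabulate g) f ≡ sum (f ∘ g)
  ΣL-tabulate {m = zero}  g f = refl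
  ΣL-tabulate {m = suc m} g f = cong (_+_ (f (g zero))) (ΣL-tabulate (g ∘ suc) f)

  ΣL-box-suc : ∀ n c (F : (Fin (suc n) → ℤ) → Carrier) →
               ΣL (box (suc n) c) F ≈ sum {c} (λ k → ΣL (box n c) (λ v → F (+ toℕ k ∷ᵛ v)))
  ΣL-box-suc n c F = begin
    ΣL (box (suc n) c) F
      ≈⟨ ΣL-concatMap slice (allFin c) F ⟩
    ΣL (allFin c) (λ k → ΣL (slice k) F)
      ≈⟨ ΣL-cong (allFin c) (λ k → reflexive (ΣL-map (+ toℕ k ∷ᵛ_) (box n c) F)) ⟩
    ΣL (allFin c) (λ k → ΣL (box n c) (λ v → F (+ toℕ k ∷ᵛ v)))
      ≡⟨ ΣL-tabulate {m = c} id (λ k → ΣL (box n c) (λ v → F (+ toℕ k ∷ᵛ v))) ⟩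
    sum {c} (λ k → ΣL (box n c) (λ v → F (+ toℕ k ∷ᵛ v)))
      ∎
    where
    slice : Fin c → List (Fin (suc n) → ℤ)
    slice k = map (+ toℕ k ∷ᵛ_) (box n c)

  ∑-cong : ∀ {m} {f g : Fin m → Carrier} → (∀ k → f k ≈ g k) → sum f ≈ sum g
  ∑-cong = sum-cong-≋

  ∑-rotate : ∀ c (h : ℕ → Carrier) → h c ≈ h 0 →
             sum {c} (λ k → h (suc (toℕ k))) ≈ sum {c} (h ∘ toℕ)
  ∑-rotate zero    h _     = ≈-refl
  ∑-rotate (suc c) h hc≈h0 = begin
    sum {suc c} (λ k → h (suc (toℕ k)))
      ≈⟨ sum-init-last (λ k → h (suc (toℕ k))) ⟩
    sum {c} (λ k → h (suc (toℕ (Fin.inject₁ k)))) + h (suc (toℕ (Fin.fromℕ c)))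
      ≈⟨ +-cong (reflexive (sum-cong-≗ {c} (λ k → cong (h ∘ suc) (Finₚ.toℕ-inject₁ k))))
                (≈-trans (reflexive (cong (h ∘ suc) (Finₚ.toℕ-fromℕ c))) hc≈h0) ⟩
    sum {c} (λ k → h (suc (toℕ k))) + h 0
      ≈⟨ +-comm _ _ ⟩
    h 0 + sum {c} (λ k → h (suc (toℕ k)))
      ∎

  ∑-translate : ∀ c (g : ℤ → Carrier) → (∀ m → g (m ℤ.+ + c) ≈ g m) →
                ∀ z → sum {c} (λ k → g (z ℤ.+ + toℕ k)) ≈ sum {c} (λ k → g (+ toℕ k))
  ∑-translate c g g-periodic = T-const
    where
    T : ℤ → Carrier
    T z = sum {c} (λ k → g (z ℤ.+ + toℕ k))

    T-suc : ∀ z → T (z ℤ.+ + 1) ≈ T z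
    T-suc z = begin
      T (z ℤ.+ + 1)
        ≡⟨ sum-cong-≗ {c} (λ k → cong g (ℤₚ.+-assoc z (+ 1) (+ toℕ k))) ⟩
      sum {c} (λ k → g (z ℤ.+ + suc (toℕ k)))
        ≈⟨ ∑-rotate c (λ m → g (z ℤ.+ + m)) (≈-trans (g-periodic z) (reflexive (cong g z≡z+0))) ⟩
      T z
        ∎
      where
      z≡z+0 : z ≡ z ℤ.+ + 0
      z≡z+0 = sym (ℤₚ.+-identityʳ z)

    -- On negative integers T-suc applies as is, since -[1+ suc m ] ℤ.+ + 1 computes to -[1+ m ].
    T-const : ∀ z → T z ≈ T (+ 0)
    T-const (+ zero)     = ≈-refl
    T-const (+ suc m)    = ≈-trans (reflexive (cong (T ∘ +_) (ℕₚ.+-comm 1 m)))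
                                   (≈-trans (T-suc (+ m)) (T-const (+ m)))
    T-const -[1+ zero ]  = ≈-sym (T-suc -[1+ zero ])
    T-const -[1+ suc m ] = ≈-trans (≈-sym (T-suc -[1+ suc m ])) (T-const -[1+ m ])

  module _ (c : ℕ) where

    open CongModProperties c

    Periodic : ∀ {n} → ((Fin n → ℤ) → Carrier) → Set ℓ
    Periodic F = ∀ v v′ → CongMod c v v′ → F v ≈ F v′

    box-translate : ∀ n (F : (Fin n → ℤ) → Carrier) → Periodic F →
                    ∀ z → ΣL (box n c) (λ v → F (v +ᶻ z)) ≈ ΣL (box n c) F
    box-translate zero    F F-periodic z = +-congʳ (F-periodic _ _ ((λ ()) , (λ ())))
    box-translate (suc n) F F-periodic z = begin
      ΣL (box (suc n) c) (λ v → F (v +ᶻ z))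
        ≈⟨ ΣL-box-suc n c _ ⟩
      sum {c} (λ k → ΣL (box n c) (λ v → F ((+ toℕ k ∷ᵛ v) +ᶻ z)))
        ≈⟨ ∑-cong {c} (λ k → ΣL-cong (box n c) (λ v → F-periodic _ _ (≗⇒CongMod _ _ (regroup k v)))) ⟩
      sum {c} (λ k → ΣL (box n c) (λ v → F ((z zero ℤ.+ + toℕ k) ∷ᵛ (v +ᶻ z ∘ suc))))
        ≈⟨ ∑-cong {c} (λ k → box-translate n _ (F-tail-periodic (z zero ℤ.+ + toℕ k)) (z ∘ suc)) ⟩
      sum {c} (λ k → g (z zero ℤ.+ + toℕ k))
        ≈⟨ ∑-translate c g g-periodic (z zero) ⟩
      sum {c} (λ k → g (+ toℕ k))
        ≈⟨ ΣL-box-suc n c F ⟨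
      ΣL (box (suc n) c) F
        ∎
      where
      g : ℤ → Carrier
      g m = ΣL (box n c) (λ v → F (m ∷ᵛ v))

      g-periodic : ∀ m → g (m ℤ.+ + c) ≈ g m
      g-periodic m = ΣL-cong (box n c) (λ v → ≈-sym (F-periodic _ _ (CongMod-+c∷ m v)))

      F-tail-periodic : ∀ m → Periodic (λ v → F (m ∷ᵛ v))
      F-tail-periodic m v v′ v≡v′ = F-periodic (m ∷ᵛ v) (m ∷ᵛ v′) (CongMod-∷ m v v′ v≡v′)

      regroup : ∀ (k : Fin c) v i → ((+ toℕ k ∷ᵛ v) +ᶻ z) i ≡ ((z zero ℤ.+ + toℕ k) ∷ᵛ (v +ᶻ z ∘ suc)) i
      regroup k v zero    = ℤₚ.+-comm (+ toℕ k) (z zero)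
      regroup k v (suc i) = refl

module RingSums {r ℓ} (R : CommutativeRing r ℓ) where

  open CommutativeRing R renaming (refl to ≈-refl; sym to ≈-sym; trans to ≈-trans)
  open SumOverBox +-commutativeMonoid public
  open import Algebra.Properties.Ring ring using ([y-z]x≈yx-zx)
  open import Algebra.Properties.Group +-group using (x∙y⁻¹≈ε⇒x≈y)
  open import Relation.Binary.Reasoning.Setoid setoid

  *-distribˡ-ΣL : ∀ {A : Set} (xs : List A) k (f : A → Carrier) → ΣL xs (λ x → k * f x) ≈ k * ΣL xs f
  *-distribˡ-ΣL []       k f = ≈-sym (zeroʳ k)
  *-distribˡ-ΣL (x ∷ xs) k f = ≈-trans (+-congˡ (*-distribˡ-ΣL xs k f)) (≈-sym (distribˡ k _ _))

  module _ {A : Set} {P : Pred A 0ℓ} (P? : Decidable P) (f : A → Carrier) where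

    restrict : A → Carrier
    restrict v with P? v
    ... | yes _ = f v
    ... | no  _ = 0#

    ΣL-filter : ∀ xs → ΣL (filter P? xs) f ≈ ΣL xs restrict
    ΣL-filter []       = ≈-refl
    ΣL-filter (x ∷ xs) with P? x
    ... | yes _ = +-congˡ (ΣL-filter xs)
    ... | no  _ = ≈-trans (ΣL-filter xs) (≈-sym (+-identityˡ _))

    restrict-* : ∀ {v v′} k → (P v → P v′) → (P v′ → P v) → (P v → f v′ ≈ k * f v) →
                 restrict v′ ≈ k * restrict v
    restrict-* {v} {v′} k to from f-rel with P? v | P? v′
    ... | yes Pv  | yes _    = f-rel Pv
    ... | no  _   | no  _    = ≈-sym (zeroʳ k)
    ... | yes Pv  | no  ¬Pv′ = ⊥-elim (¬Pv′ (to Pv))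
    ... | no  ¬Pv | yes Pv′  = ⊥-elim (¬Pv (from Pv′))

  x≈y*x⇒y≈1⊎x≈0 : IsIntegralDomain R → ∀ {x y} → x ≈ y * x → y ≈ 1# ⊎ x ≈ 0#
  x≈y*x⇒y≈1⊎x≈0 domain {x} {y} x≈yx =
    Sum.map₁ (≈-sym ∘ x∙y⁻¹≈ε⇒x≈y 1# y) (IsIntegralDomain.noZeroDivisors domain (1# - y) x [1-y]x≈0)
    where
    [1-y]x≈0 : (1# - y) * x ≈ 0#
    [1-y]x≈0 = begin
      (1# - y) * x    ≈⟨ [y-z]x≈yx-zx x 1# y ⟩
      1# * x - y * x  ≈⟨ +-cong (*-identityˡ x) (-‿cong (≈-sym x≈yx)) ⟩
      x - x           ≈⟨ -‿inverseʳ x ⟩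
      0#              ∎

∀-⊎ : ∀ {m b p} {A : Fin m → Set p} {B : Set b} → (∀ i → A i ⊎ B) → (∀ i → A i) ⊎ B
∀-⊎ {zero}  f = inj₁ (λ ())
∀-⊎ {suc m} f with f zero | ∀-⊎ (f ∘ suc)
... | inj₂ b  | _        = inj₂ b
... | inj₁ _  | inj₂ b   = inj₂ b
... | inj₁ a₀ | inj₁ aₛ = inj₁ (Finₚ.∀-cons a₀ aₛ)

CGinvℤ : ∀ {n} → ℕ → RatMat n → Pred (Fin n → ℤ) 0ℓ
CGinvℤ {n} c Ginv z = ∃ λ (s : Fin n → ℤ) → ∀ j → ι (z j) ≡ ι (+ c) ℚ.* (Ginv ·ℤ s) j

module CGinvℤ-Properties (c : ℕ) {n} (Ginv : RatMat n) where

  open CongModProperties c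

  κ : ℚ
  κ = ι (+ c)

  CGinvℤ-neg : ∀ z → CGinvℤ c Ginv z → CGinvℤ c Ginv (λ j → ℤ.- z j)
  CGinvℤ-neg z (s , z≡κGinvs) = (λ j → ℤ.- s j) , λ j → begin
    ι (ℤ.- z j)                          ≡⟨ ι-homo‿- (z j) ⟩
    ℚ.- ι (z j)                          ≡⟨ cong ℚ.-_ (z≡κGinvs j) ⟩
    ℚ.- (κ ℚ.* (Ginv ·ℤ s) j)            ≡⟨ ℚₚ.neg-distribʳ-* κ _ ⟩
    κ ℚ.* ℚ.- (Ginv ·ℤ s) j              ≡⟨ cong (κ ℚ.*_) (·ℤ-neg Ginv s j) ⟨
    κ ℚ.* (Ginv ·ℤ (λ j → ℤ.- s j)) j    ∎
    where open ≡-Reasoning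

  S-invariant : ∀ x → InvariantMod c (S[ c , Ginv , x ])
  S-invariant x v v′ v≡v′ (y , v≡y , y∈x+cGinv) =
    y , CongMod-trans v′ v y (CongMod-sym v v′ v≡v′) v≡y , y∈x+cGinv

  S-translate : ∀ x z → CGinvℤ c Ginv z → ∀ v → S[ c , Ginv , x ] v → S[ c , Ginv , x ] (v +ᶻ z)
  S-translate x z (s , z≡κGinvs) v (y , v≡y , (t , y≡x+κGinvt)) =
    y +ᶻ z , CongMod-+ᶻ v y z v≡y , (λ j → t j ℤ.+ s j) , λ j → begin
      ι (y j ℤ.+ z j)
        ≡⟨ ι-homo-+ (y j) (z j) ⟩
      ι (y j) ℚ.+ ι (z j)
        ≡⟨ cong₂ ℚ._+_ (y≡x+κGinvt j) (z≡κGinvs j) ⟩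
      (ι (x j) ℚ.+ κ ℚ.* (Ginv ·ℤ t) j) ℚ.+ κ ℚ.* (Ginv ·ℤ s) j
        ≡⟨ regroup (ι (x j)) κ _ _ ⟩
      ι (x j) ℚ.+ κ ℚ.* ((Ginv ·ℤ t) j ℚ.+ (Ginv ·ℤ s) j)
        ≡⟨ cong (λ q → ι (x j) ℚ.+ κ ℚ.* q) (·ℤ-+ Ginv t s j) ⟨
      ι (x j) ℚ.+ κ ℚ.* (Ginv ·ℤ (λ j → t j ℤ.+ s j)) j
        ∎
    where
    open ≡-Reasoning
    regroup : ∀ x k p q → (x ℚ.+ k ℚ.* p) ℚ.+ k ℚ.* q ≡ x ℚ.+ k ℚ.* (p ℚ.+ q)
    regroup = RingSolver.solve-∀ ℚ-ring

module GaussSumVanishing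
  {r ℓ} (R : CommutativeRing r ℓ) (domain : IsIntegralDomain R)
  (e : ℚ → CommutativeRing.Carrier R) (isExp : IsExp R e)
  {n : ℕ} (G : IntMat n) (G-even : EvenIntegral G)
  (Ginv : RatMat n) (inverse : IsInverse G Ginv)
  (a : ℤ) (c : ℕ) .{{_ : NonZero c}} (cGinv-even : EvenIntegralℚ (scaleMat c Ginv))
  (w : Fin n → ℚ) (u : Fin n → ℤ) (w≡Ginv·u : ∀ i → w i ≡ (Ginv ·ℤ u) i)
  where

  open CommutativeRing R renaming (refl to ≈-refl; sym to ≈-sym; trans to ≈-trans)
  open IsExp isExp
  open RingSums R
  open BilinearForm G
  open CGinvℤ-Properties c Ginv
  open import Relation.Binary.Reasoning.Setoid setoid

  G-sym : Symmetric G
  G-sym = proj₁ G-even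

  x̂ : (Fin n → ℤ) → Fin n → ℚ
  x̂ v i = ι (v i) ℚ.+ w i

  term : (Fin n → ℤ) → Carrier
  term v = e ((a / c) ℚ.* (½ ℚ.* quadℚ G (x̂ v)))

  term-cong : ∀ {v v′} → (∀ i → v i ≡ v′ i) → term v ≡ term v′
  term-cong v≗v′ =
    cong (λ q → e ((a / c) ℚ.* (½ ℚ.* q))) (quadℚ-cong (λ i → cong (λ m → ι m ℚ.+ w i) (v≗v′ i)))

  IsInt-G·x̂ : ∀ v i → IsInt ((toℚMat G ·ᵛ x̂ v) i)
  IsInt-G·x̂ v i = subst IsInt (sym G·x̂≡G·v+u)
    (IsInt-+ (IsInt-Σℚ n (λ j → IsInt-* (G i j , refl) (v j , refl))) (u i , refl))
    where
    G·x̂≡G·v+u : (toℚMat G ·ᵛ x̂ v) i ≡ (toℚMat G ·ℤ v) i ℚ.+ ι (u i)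
    G·x̂≡G·v+u = trans (·ᵛ-distrib-+ (toℚMat G) _ w i)
      (cong ((toℚMat G ·ℤ v) i ℚ.+_) (trans (·ᵛ-cong (toℚMat G) w≡Ginv·u i) (G·[Ginv·u]≡u inverse u i)))

  term-translate : ∀ v z y → (∀ i → ι (z i) ≡ κ ℚ.* y i) →
                   term (v +ᶻ z) ≈ term v * e (ι a ℚ.* (⟪ y , x̂ v ⟫ ℚ.+ κ ℚ.* (½ ℚ.* quadℚ G y)))
  term-translate v z y z≡κy = begin
    term (v +ᶻ z)
      ≡⟨ cong (λ q → e ((a / c) ℚ.* (½ ℚ.* q))) (quadℚ-cong x̂[v+z]≡x̂v+κy) ⟩
    e ((a / c) ℚ.* (½ ℚ.* quadℚ G (λ i → x̂ v i ℚ.+ κ ℚ.* y i)))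
      ≡⟨ cong e (quadℚ-translate G-sym a c (x̂ v) y) ⟩
    e ((a / c) ℚ.* (½ ℚ.* quadℚ G (x̂ v)) ℚ.+ ι a ℚ.* (⟪ y , x̂ v ⟫ ℚ.+ κ ℚ.* (½ ℚ.* quadℚ G y)))
      ≈⟨ hom _ _ ⟩
    term v * e (ι a ℚ.* (⟪ y , x̂ v ⟫ ℚ.+ κ ℚ.* (½ ℚ.* quadℚ G y)))
      ∎
    where
    x̂[v+z]≡x̂v+κy : ∀ i → x̂ (v +ᶻ z) i ≡ x̂ v i ℚ.+ κ ℚ.* y i
    x̂[v+z]≡x̂v+κy i = trans (cong (ℚ._+ w i) (ι-homo-+ (v i) (z i)))
                           (trans (ℚ+.xy∙z≈xz∙y (ι (v i)) (ι (z i)) (w i)) (cong (x̂ v i ℚ.+_) (z≡κy i)))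

  term-periodic : Periodic c term
  term-periodic v v′ (k , v′≡v+ck) = ≈-sym (begin
    term v′                          ≡⟨ term-cong v′≡v+ck ⟩
    term (v +ᶻ (λ i → + c ℤ.* k i))  ≈⟨ term-translate v _ (ι ∘ k) (λ i → ι-homo-* (+ c) (k i)) ⟩
    term v * e _                     ≈⟨ *-congˡ (int⇒one _ exponent-integral) ⟩
    term v * 1#                      ≈⟨ *-identityʳ (term v) ⟩
    term v                           ∎)
    where
    exponent-integral : IsInt (ι a ℚ.* (⟪ ι ∘ k , x̂ v ⟫ ℚ.+ κ ℚ.* (½ ℚ.* quadℚ G (ι ∘ k))))
    exponent-integral = IsInt-* (a , refl)
      (IsInt-+ (IsInt-Σℚ n (λ i → IsInt-* (k i , refl) (IsInt-G·x̂ v i)))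
               (IsInt-* (+ c , refl) (IsInt-½*quadℚ G G-even (ι ∘ k) (λ i → k i , refl))))

  cGinv-column : Fin n → Fin n → ℤ
  cGinv-column i k = proj₁ (proj₁ cGinv-even k i)

  cGinv-column≡κGinv : ∀ i k → ι (cGinv-column i k) ≡ κ ℚ.* Ginv k i
  cGinv-column≡κGinv i k = sym (proj₂ (proj₁ cGinv-even k i))

  cGinv-column∈CGinvℤ : ∀ i → CGinvℤ c Ginv (cGinv-column i)
  cGinv-column∈CGinvℤ i =
    δ i , λ k → trans (cGinv-column≡κGinv i k) (cong (κ ℚ.*_) (sym (·ℤ-δ Ginv i k)))

  term-translate-cGinv-column : ∀ i v → term (v +ᶻ cGinv-column i) ≈ e (ι a ℚ.* w i) * term v
  term-translate-cGinv-column i v = begin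
    term (v +ᶻ cGinv-column i)
      ≈⟨ term-translate v (cGinv-column i) Ginvᵢ (cGinv-column≡κGinv i) ⟩
    term v * e (ι a ℚ.* (⟪ Ginvᵢ , x̂ v ⟫ ℚ.+ κ ℚ.* (½ ℚ.* quadℚ G Ginvᵢ)))
      ≡⟨ cong (λ p → term v * e p) exponent≡ ⟩
    term v * e (ι a ℚ.* w i ℚ.+ ι a ℚ.* (ι (v i) ℚ.+ κ ℚ.* (½ ℚ.* Ginv i i)))
      ≈⟨ *-congˡ (hom _ _) ⟩
    term v * (e (ι a ℚ.* w i) * e (ι a ℚ.* (ι (v i) ℚ.+ κ ℚ.* (½ ℚ.* Ginv i i))))
      ≈⟨ *-congˡ (*-congˡ (int⇒one _ remainder-integral)) ⟩
    term v * (e (ι a ℚ.* w i) * 1#)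
      ≈⟨ ≈-trans (*-congˡ (*-identityʳ _)) (*-comm _ _) ⟩
    e (ι a ℚ.* w i) * term v
      ∎
    where
    Ginvᵢ : Fin n → ℚ
    Ginvᵢ k = Ginv k i

    remainder-integral : IsInt (ι a ℚ.* (ι (v i) ℚ.+ κ ℚ.* (½ ℚ.* Ginv i i)))
    remainder-integral = IsInt-* (a , refl) (IsInt-+ (v i , refl) (IsInt-c*½*diag c cGinv-even i))

    exponent≡ : ι a ℚ.* (⟪ Ginvᵢ , x̂ v ⟫ ℚ.+ κ ℚ.* (½ ℚ.* quadℚ G Ginvᵢ))
              ≡ ι a ℚ.* w i ℚ.+ ι a ℚ.* (ι (v i) ℚ.+ κ ℚ.* (½ ℚ.* Ginv i i))
    exponent≡ = trans (cong₂ (λ p q → ι a ℚ.* (p ℚ.+ κ ℚ.* (½ ℚ.* q)))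
                             (⟪Ginvᵢ,x⟫≡xᵢ G-sym inverse i (x̂ v))
                             (trans (quadℚ≡⟪⟫ Ginvᵢ) (⟪Ginvᵢ,x⟫≡xᵢ G-sym inverse i Ginvᵢ)))
                      (regroup (ι a) (ι (v i)) (w i) _)
      where
      regroup : ∀ a x w m → a ℚ.* ((x ℚ.+ w) ℚ.+ m) ≡ a ℚ.* w ℚ.+ a ℚ.* (x ℚ.+ m)
      regroup = RingSolver.solve-∀ ℚ-ring

  module _ {P : Pred (Fin n → ℤ) 0ℓ} (P? : Decidable P) (P-invariant : InvariantMod c P)
           (P-translate : ∀ z → CGinvℤ c Ginv z → ∀ v → P v → P (v +ᶻ z)) where

    open CongModProperties c

    summand : (Fin n → ℤ) → Carrier
    summand = restrict P? term

    summand-periodic : Periodic c summand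
    summand-periodic v v′ v≡v′ = ≈-sym (≈-trans
      (restrict-* P? term 1# (P-invariant v v′ v≡v′) (P-invariant v′ v (CongMod-sym v v′ v≡v′))
                  (λ _ → ≈-trans (≈-sym (term-periodic v v′ v≡v′)) (≈-sym (*-identityˡ _))))
      (*-identityˡ _))

    summand-translate : ∀ i v → summand (v +ᶻ cGinv-column i) ≈ e (ι a ℚ.* w i) * summand v
    summand-translate i v = restrict-* P? term _
      (P-translate _ (cGinv-column∈CGinvℤ i) v) P-back (λ _ → term-translate-cGinv-column i v)
      where
      x+y-y≡x : ∀ x y → (x ℤ.+ y) ℤ.+ ℤ.- y ≡ x
      x+y-y≡x = ℤ-Solver.solve-∀

      P-back : P (v +ᶻ cGinv-column i) → P v
      P-back P[v+z] = P-invariant _ v (≗⇒CongMod _ v (λ k → x+y-y≡x (v k) (cGinv-column i k)))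
        (P-translate _ (CGinvℤ-neg (cGinv-column i) (cGinv-column∈CGinvℤ i)) _ P[v+z])

    Σsummand-fixed : ∀ i → ΣL (box n c) summand ≈ e (ι a ℚ.* w i) * ΣL (box n c) summand
    Σsummand-fixed i = begin
      ΣL (box n c) summand
        ≈⟨ box-translate c n summand summand-periodic (cGinv-column i) ⟨
      ΣL (box n c) (λ v → summand (v +ᶻ cGinv-column i))
        ≈⟨ ΣL-cong (box n c) (summand-translate i) ⟩
      ΣL (box n c) (λ v → e (ι a ℚ.* w i) * summand v)
        ≈⟨ *-distribˡ-ΣL (box n c) _ summand ⟩
      e (ι a ℚ.* w i) * ΣL (box n c) summand
        ∎

    gaussSum≈0 : ¬ (∀ i → IsInt (ι a ℚ.* w i)) → GaussSum R e G a c w P P? ≈ 0#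
    gaussSum≈0 a·w∉ℤⁿ = ≈-trans (ΣL-filter P? term (box n c))
      (Sum.[ ⊥-elim ∘ a·w∉ℤⁿ , id ]′
        (∀-⊎ (λ i → Sum.map₁ (one⇒int _) (x≈y*x⇒y≈1⊎x≈0 domain (Σsummand-fixed i)))))

-- Imported this late because the ring modules above use _*_ for the multiplication of R.
open import Data.Rational using (_*_)

proposition6p1 : {r ℓ : Level} (R : CommutativeRing r ℓ) → IsIntegralDomain R →
    (e : ℚ → CommutativeRing.Carrier R) → IsExp R e →
    (n : ℕ) → 1 ≤ n →
    (G : IntMat n) → EvenIntegral G → PositiveDefinite G →
    (Ginv : RatMat n) → IsInverse G Ginv →
    (N : ℕ) → IsLevel Ginv N →
    (a : ℤ) → ¬ (a ≡ + 0) →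
    (c : ℕ) → .{{_ : NonZero c}} → gcd a (+ c) ≡ + 1 → N ∣ c →
    (w : Fin n → ℚ) → (∃ λ (u : Fin n → ℤ) → ∀ i → w i ≡ (Ginv ·ℤ u) i) →
    ¬ (∀ i → IsInt (ι a * w i)) →
    ((H : Pred (Fin n → ℤ) Level.zero) → (decH : Decidable H) →
       IsSubgroupMod c H → ContainsCGinv c Ginv H →
       CommutativeRing._≈_ R (GaussSum R e G a c w H decH) (CommutativeRing.0# R))
    × ((x : Fin n → ℤ) → (decS : Decidable (S[ c , Ginv , x ])) →
       CommutativeRing._≈_ R (GaussSum R e G a c w (S[ c , Ginv , x ]) decS) (CommutativeRing.0# R))
proposition6p1 R domain e isExp n _ G G-even _ Ginv inverse N (_ , NGinv-even , _)
               a _ c _ N∣c w (u , w≡Ginv·u) a·w∉ℤⁿ =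
  (λ H H? (H-invariant , _ , H-+ , _) H⊇cGinvℤ →
     gaussSum≈0 H? H-invariant (λ z (s , z≡κGinvs) v Hv → H-+ v z Hv (H⊇cGinvℤ s z z≡κGinvs)) a·w∉ℤⁿ) ,
  (λ x S? → gaussSum≈0 S? (S-invariant x) (S-translate x) a·w∉ℤⁿ)
  where
  open GaussSumVanishing R domain e isExp G G-even Ginv inverse a c
                         (EvenIntegralℚ-scaleMat-∣ N∣c NGinv-even) w u w≡Ginv·u
  open CGinvℤ-Properties c Ginv using (S-invariant; S-translate)
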